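{- Let $a,d,r\in\mathbb Z$, $r_1=r+d$, and assume $a,d,r_1\ne0$. Let $h(n,k)$ ($n,k\ge0$) be numbers with $h(n,k)=0$ whenever $k>n$, so that the matrices $h_n=(h(i,j))_{0\le i,j\le n-1}$ are lower triangular for all $n$. Then [$h(0,0)=1$ and $h(n,k)=(an+dk-r)h(n-1,k)+h(n-1,k-1)$ for all $n\ge1$, $0\le k\le n$, with $h(n-1,-1):=0$] if and only if for all $n\ge1$ $$h_n=(a_nc_na_n^{ -1})(\hat r_nP_n^{ -1}\hat r_n^{ -1})(d_nS_nd_n^{ -1}).$$
   Context: All matrices are $n\times n$: $c_n=(c(i,j))_{1\le i,j\le n}$ where $c(i,j)$ are the signless Stirling numbers of the first kind; $S_n=(S(i,j))_{1\le i,j\le n}$ where $S(i,j)$ are the Stirling numbers of the second kind; $P_n=(\binom ij)_{0\le i,j\le n-1}$; $a_n=\mathrm{diag}(1,a,a^2,\dots,a^{n-1})$, $d_n=\mathrm{diag}(1,d,\dots,d^{n-1})$, $\hat r_n=\mathrm{diag}(1,r_1,r_1^2,\dots,r_1^{n-1})$. In the product, the $(p,q)$ entry ($0\le p,q\le n-1$) of $h_n$ is compared with the $(p+1,q+1)$ entry of the product of matrices indexed from $1$. -}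

module Defs where

open import Data.Nat as ℕ using (ℕ; zero; suc)
open import Data.Integer as ℤ using (ℤ)
open import Data.Rational as ℚ using (ℚ; 0ℚ; 1ℚ; _+_; _*_; -_; 1/_)
open import Data.Rational.Properties using (_≟_)
open import Data.Fin using (Fin; toℕ)
open import Data.Nat.Combinatorics using (_C_)
open import Relation.Nullary using (yes; no)
open import Relation.Binary.PropositionalEquality using (_≡_; _≢_)
open import Data.Product using (_×_)

infixr 8 _^_
_^_ : ℚ → ℕ → ℚ
x ^ zero = 1ℚ
x ^ suc n = x * (x ^ n)

-- total inverse on ℚ (0 ↦ 0); on nonzero arguments it is the true inverse 1/x
inv : ℚ → ℚ
inv x with x ≟ 0ℚ
... | yes _ = 0ℚ
... | no x≢0 = 1/_ x {{ℚ.≢-nonZero x≢0}}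

stir1 : ℕ → ℕ → ℕ
stir1 zero zero = 1
stir1 zero (suc k) = 0
stir1 (suc n) zero = 0
stir1 (suc n) (suc k) = n ℕ.* stir1 n (suc k) ℕ.+ stir1 n k

stir2 : ℕ → ℕ → ℕ
stir2 zero zero = 1
stir2 zero (suc k) = 0
stir2 (suc n) zero = 0
stir2 (suc n) (suc k) = suc k ℕ.* stir2 n (suc k) ℕ.+ stir2 n k

Mat : ℕ → Set
Mat n = Fin n → Fin n → ℚ

Σ : ∀ {n} → (Fin n → ℚ) → ℚ
Σ {zero} f = 0ℚ
Σ {suc n} f = f Fin.zero + Σ (λ i → f (Fin.suc i))

infixl 7 _⊗_
_⊗_ : ∀ {n} → Mat n → Mat n → Mat n
(A ⊗ B) i j = Σ (λ k → A i k * B k j)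

diagPow : ∀ n → ℚ → Mat n
diagPow n x i j with toℕ i ℕ.≟ toℕ j
... | yes _ = x ^ toℕ i
... | no _ = 0ℚ

diagPowInv : ∀ n → ℚ → Mat n
diagPowInv n x = diagPow n (inv x)

fromℕ : ℕ → ℚ
fromℕ m = ℤ.+ m ℚ./ 1

-- c_n = (c(i,j))_{1≤i,j≤n}: entry (p,q), 0-based, is c(p+1,q+1)
cMat : ∀ n → Mat n
cMat n p q = fromℕ (stir1 (suc (toℕ p)) (suc (toℕ q)))

SMat : ∀ n → Mat n
SMat n p q = fromℕ (stir2 (suc (toℕ p)) (suc (toℕ q)))

PMat : ∀ n → Mat n
PMat n p q = fromℕ (toℕ p C toℕ q)

-- P_n⁻¹ = ((-1)^{i-j} binom(i,j))_{0≤i,j≤n-1}  (binomial inversion)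
PInvMat : ∀ n → Mat n
PInvMat n p q = ((- 1ℚ) ^ (toℕ p ℕ.∸ toℕ q)) * fromℕ (toℕ p C toℕ q)

hMat : (ℕ → ℕ → ℚ) → ∀ n → Mat n
hMat h n p q = h (toℕ p) (toℕ q)

hPrev : (ℕ → ℕ → ℚ) → ℕ → ℕ → ℚ
hPrev h m zero = 0ℚ
hPrev h m (suc k) = h m k

Recurrence : ℤ → ℤ → ℤ → (ℕ → ℕ → ℚ) → Set
Recurrence a d r h =
  (h 0 0 ≡ 1ℚ) ×
  (∀ m k → k ℕ.≤ suc m →
     h (suc m) k ≡ (((a ℚ./ 1) * fromℕ (suc m) + (d ℚ./ 1) * fromℕ k ℚ.- (r ℚ./ 1)) * h m k + hPrev h m k))

Factorization : ℤ → ℤ → ℤ → (ℕ → ℕ → ℚ) → ℕ → Set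
Factorization a d r h n =
  ∀ p q → hMat h n p q ≡
    ((diagPow n a' ⊗ cMat n ⊗ diagPowInv n a') ⊗
    (diagPow n r₁ ⊗ PInvMat n ⊗ diagPowInv n r₁) ⊗
    (diagPow n d' ⊗ SMat n ⊗ diagPowInv n d')) p q
  where a' = a ℚ./ 1
        d' = d ℚ./ 1
        r₁ = (r ℤ.+ d) ℚ./ 1

{-# OPTIONS --safe #-}

-- Call a lower-triangular array X recurrent with weight w if
-- X(n+1,k) = w(n,k) X(n,k) + X(n,k-1).  If X has a weight α(n) depending only on the row and
-- Y a weight β(k) depending only on the column, then X Y is recurrent with weight α(n) + β(k):
-- the term X(n,k-1) of row n+1 of X shifts the summation onto row m+1 of Y.  The arrays c, P⁻¹
-- and S are recurrent with weights n+1, -1 and k+1, and conjugating by diag(x^n) multiplies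
-- a weight by x, so the product of the three factors is recurrent with weight
-- a(n+1) - r₁ + d(k+1) = a(n+1) + dk - r.  A lower-triangular recurrent array is determined by
-- its (0,0) entry, and for lower-triangular arrays truncation to n × n commutes with products.
module Submission where

open import Defs
open import Data.Nat as ℕ using (ℕ; zero; suc; _≤_; _<_; _≤′_; ≤′-refl; ≤′-step; z≤n; s≤s)
import Data.Nat.Properties as ℕP
open import Data.Nat.Combinatorics using (_C_; k>n⇒nCk≡0; nCk+nC[k+1]≡[n+1]C[k+1])
open import Data.Integer as ℤ using (ℤ; 0ℤ)
import Data.Integer.Properties as ℤP
open import Data.Rational as ℚ using (ℚ; 0ℚ; 1ℚ; _+_; _*_; -_; mkℚ)
import Data.Rational.Properties as ℚP
open import Data.Rational.Solver using (module +-*-Solver)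
import Data.Nat.Coprimality as Coprimality
open import Data.Fin as Fin using (Fin; toℕ)
import Data.Fin.Properties as FinP
open import Data.Vec.Functional using (removeAt)
open import Algebra.Bundles using (Ring)
open import Algebra.Properties.Semiring.Sum (Ring.semiring ℚP.+-*-ring)
open import Data.Empty using (⊥-elim)
open import Data.Product using (_,_)
open import Function using (_∘_; _⇔_; mk⇔)
open import Relation.Nullary using (yes; no)
open import Relation.Binary.PropositionalEquality
open +-*-Solver
open ≡-Reasoning

-- On arguments of the form mkℚ i 0, ℚ's _+_ and _*_ reduce to (i * 1 + j * 1) / 1 and (i * j) / 1.
/1≡mkℚ : ∀ i → i ℚ./ 1 ≡ mkℚ i 0 (Coprimality.sym (Coprimality.1-coprimeTo _))
/1≡mkℚ i = ℚP.↥p/↧p≡p (mkℚ i 0 _)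

/1-homo-+ : ∀ i j → (i ℤ.+ j) ℚ./ 1 ≡ (i ℚ./ 1) + (j ℚ./ 1)
/1-homo-+ i j = trans
  (cong₂ (λ x y → (x ℤ.+ y) ℚ./ 1) (sym (ℤP.*-identityʳ i)) (sym (ℤP.*-identityʳ j)))
  (cong₂ _+_ (sym (/1≡mkℚ i)) (sym (/1≡mkℚ j)))

/1-homo-* : ∀ i j → (i ℤ.* j) ℚ./ 1 ≡ (i ℚ./ 1) * (j ℚ./ 1)
/1-homo-* i j = cong₂ _*_ (sym (/1≡mkℚ i)) (sym (/1≡mkℚ j))

/1-≢0 : ∀ i → i ≢ 0ℤ → i ℚ./ 1 ≢ 0ℚ
/1-≢0 i i≢0 i/1≡0 = i≢0 (trans (cong ℚ.numerator (sym (/1≡mkℚ i))) (cong ℚ.numerator i/1≡0))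

fromℕ-homo-+ : ∀ m n → fromℕ (m ℕ.+ n) ≡ fromℕ m + fromℕ n
fromℕ-homo-+ m n = /1-homo-+ (ℤ.+ m) (ℤ.+ n)

fromℕ-homo-* : ∀ m n → fromℕ (m ℕ.* n) ≡ fromℕ m * fromℕ n
fromℕ-homo-* m n = trans (cong (ℚ._/ 1) (ℤP.pos-* m n)) (/1-homo-* (ℤ.+ m) (ℤ.+ n))

inv-inverseʳ : ∀ x → x ≢ 0ℚ → x * inv x ≡ 1ℚ
inv-inverseʳ x x≢0 with x ℚP.≟ 0ℚ
... | yes x≡0 = ⊥-elim (x≢0 x≡0)
... | no x≢0′ = ℚP.*-inverseʳ x {{ℚ.≢-nonZero x≢0′}}

Σ≡sum : ∀ {N} (f : Fin N → ℚ) → Σ f ≡ sum f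
Σ≡sum {zero} f = refl
Σ≡sum {suc N} f = cong (f Fin.zero +_) (Σ≡sum (f ∘ Fin.suc))

sum-zero : ∀ {N} (f : Fin N → ℚ) → (∀ i → f i ≡ 0ℚ) → sum f ≡ 0ℚ
sum-zero {N} f f≡0 = trans (sum-cong-≗ f≡0) (sum-replicate-zero N)

sum-single : ∀ {N} (f : Fin (suc N) → ℚ) p → (∀ i → i ≢ p → f i ≡ 0ℚ) → sum f ≡ f p
sum-single f p f≡0 = begin
  sum f                    ≡⟨ sum-remove {i = p} f ⟩
  f p + sum (removeAt f p) ≡⟨ cong (f p +_) (sum-zero _ (λ i → f≡0 _ (FinP.punchInᵢ≢i p i))) ⟩
  f p + 0ℚ                 ≡⟨ ℚP.+-identityʳ (f p) ⟩
  f p                      ∎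

sum-snoc : ∀ L (f : ℕ → ℚ) → ∑[ i < suc L ] f (toℕ i) ≡ ∑[ i < L ] f (toℕ i) + f L
sum-snoc L f = trans (sum-init-last {L} (f ∘ toℕ))
  (cong₂ _+_ (sum-cong-≗ {L} (cong f ∘ FinP.toℕ-inject₁)) (cong f (FinP.toℕ-fromℕ L)))

sum-vanishing-beyond : ∀ {L N} (f : ℕ → ℚ) → L ≤ N → (∀ i → L ≤ i → f i ≡ 0ℚ) →
  ∑[ i < N ] f (toℕ i) ≡ ∑[ i < L ] f (toℕ i)
sum-vanishing-beyond {L} f L≤N f≡0 = go (ℕP.≤⇒≤′ L≤N)
  where
  go : ∀ {N} → L ≤′ N → ∑[ i < N ] f (toℕ i) ≡ ∑[ i < L ] f (toℕ i)
  go ≤′-refl = refl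
  go (≤′-step {N} L≤′N) = begin
    ∑[ i < suc N ] f (toℕ i)  ≡⟨ sum-snoc N f ⟩
    ∑[ i < N ] f (toℕ i) + f N ≡⟨ cong₂ _+_ (go L≤′N) (f≡0 N (ℕP.≤′⇒≤ L≤′N)) ⟩
    ∑[ i < L ] f (toℕ i) + 0ℚ  ≡⟨ ℚP.+-identityʳ _ ⟩
    ∑[ i < L ] f (toℕ i)       ∎

Mat∞ : Set
Mat∞ = ℕ → ℕ → ℚ

LowerTriangular : Mat∞ → Set
LowerTriangular X = ∀ n k → n < k → X n k ≡ 0ℚ

infixl 7 _⊙_
_⊙_ : Mat∞ → Mat∞ → Mat∞
(X ⊙ Y) n j = ∑[ m < suc n ] (X n (toℕ m) * Y (toℕ m) j)

Recurrent : (ℕ → ℕ → ℚ) → Mat∞ → Set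
Recurrent w X = ∀ n k → X (suc n) k ≡ w n k * X n k + hPrev X n k

hPrev-cong : ∀ {X Y : Mat∞} m → (∀ k → X m k ≡ Y m k) → ∀ k → hPrev X m k ≡ hPrev Y m k
hPrev-cong m X≡Y zero = refl
hPrev-cong m X≡Y (suc k) = X≡Y k

Recurrent-resp : ∀ {w X Y} → (∀ n k → X n k ≡ Y n k) → Recurrent w X → Recurrent w Y
Recurrent-resp {w} {X} {Y} X≡Y recX n k = begin
  Y (suc n) k                        ≡⟨ sym (X≡Y (suc n) k) ⟩
  X (suc n) k                        ≡⟨ recX n k ⟩
  w n k * X n k + hPrev X n k        ≡⟨ cong₂ (λ x p → w n k * x + p) (X≡Y n k) (hPrev-cong n (X≡Y n) k) ⟩
  w n k * Y n k + hPrev Y n k        ∎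

recurrent⇒lowerTriangular : ∀ {w X} → (∀ k → X 0 (suc k) ≡ 0ℚ) → Recurrent w X → LowerTriangular X
recurrent⇒lowerTriangular X0≡0 recX zero (suc k) _ = X0≡0 k
recurrent⇒lowerTriangular {w} {X} X0≡0 recX (suc n) (suc k) (s≤s n<k) = begin
  X (suc n) (suc k)                    ≡⟨ recX n (suc k) ⟩
  w n (suc k) * X n (suc k) + X n k
    ≡⟨ cong₂ (λ x y → w n (suc k) * x + y) (below (ℕP.m<n⇒m<1+n n<k)) (below n<k) ⟩
  w n (suc k) * 0ℚ + 0ℚ                ≡⟨ cong (_+ 0ℚ) (ℚP.*-zeroʳ (w n (suc k))) ⟩
  0ℚ                                   ∎
  where
  below : ∀ {j} → n < j → X n j ≡ 0ℚ
  below = recurrent⇒lowerTriangular {w} X0≡0 recX n _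

recurrence-unique : ∀ {w X Y} → LowerTriangular X → LowerTriangular Y → X 0 0 ≡ Y 0 0 →
  (∀ m k → k ≤ suc m → X (suc m) k ≡ w m k * X m k + hPrev X m k) → Recurrent w Y →
  ∀ n k → X n k ≡ Y n k
recurrence-unique ltX ltY X₀₀≡Y₀₀ recX recY zero zero = X₀₀≡Y₀₀
recurrence-unique ltX ltY X₀₀≡Y₀₀ recX recY zero (suc k) =
  trans (ltX 0 (suc k) (s≤s z≤n)) (sym (ltY 0 (suc k) (s≤s z≤n)))
recurrence-unique {w} {X} {Y} ltX ltY X₀₀≡Y₀₀ recX recY (suc m) k with k ℕ.≤? suc m
... | yes k≤1+m = begin
  X (suc m) k                   ≡⟨ recX m k k≤1+m ⟩
  w m k * X m k + hPrev X m k   ≡⟨ cong₂ (λ x p → w m k * x + p) (X≡Y k) (hPrev-cong m X≡Y k) ⟩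
  w m k * Y m k + hPrev Y m k   ≡⟨ sym (recY m k) ⟩
  Y (suc m) k                   ∎
  where X≡Y = recurrence-unique {w} ltX ltY X₀₀≡Y₀₀ recX recY m
... | no k≰1+m = trans (ltX (suc m) k (ℕP.≰⇒> k≰1+m)) (sym (ltY (suc m) k (ℕP.≰⇒> k≰1+m)))

⊙-as-longer-sum : ∀ {X} Y → LowerTriangular X → ∀ {N} n j → n < N →
  ∑[ m < N ] (X n (toℕ m) * Y (toℕ m) j) ≡ (X ⊙ Y) n j
⊙-as-longer-sum {X} Y ltX n j n<N = sum-vanishing-beyond (λ m → X n m * Y m j) n<N
  (λ m n<m → trans (cong (_* Y m j) (ltX n m n<m)) (ℚP.*-zeroˡ (Y m j)))

LowerTriangular-⊙ : ∀ X {Y} → LowerTriangular Y → LowerTriangular (X ⊙ Y)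
LowerTriangular-⊙ X {Y} ltY n k n<k = sum-zero {suc n} (λ m → X n (toℕ m) * Y (toℕ m) k) λ m →
  trans (cong (X n (toℕ m) *_) (ltY (toℕ m) k (ℕP.<-≤-trans (FinP.toℕ<n m) n<k))) (ℚP.*-zeroʳ (X n (toℕ m)))

⊙-hPrev : ∀ X Y n j → ∑[ m < suc n ] (X n (toℕ m) * hPrev Y (toℕ m) j) ≡ hPrev (X ⊙ Y) n j
⊙-hPrev X Y n zero = sum-zero {suc n} (λ m → X n (toℕ m) * 0ℚ) (λ m → ℚP.*-zeroʳ (X n (toℕ m)))
⊙-hPrev X Y n (suc j) = refl

⊙-suc-row : ∀ {α : ℕ → ℚ} {X} (Y : Mat∞) → LowerTriangular X → Recurrent (λ n _ → α n) X → ∀ n j →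
  (X ⊙ Y) (suc n) j ≡ α n * (X ⊙ Y) n j + ∑[ m < suc n ] (X n (toℕ m) * Y (suc (toℕ m)) j)
⊙-suc-row {α} {X} Y ltX recX n j = begin
  (X ⊙ Y) (suc n) j
    ≡⟨ sum-cong-≗ {suc (suc n)} (λ m → trans (cong (_* Y (toℕ m) j) (recX n (toℕ m)))
         (distrib (α n) (X n (toℕ m)) (hPrev X n (toℕ m)) (Y (toℕ m) j))) ⟩
  ∑[ m < suc (suc n) ] (α n * (X n (toℕ m) * Y (toℕ m) j) + hPrev X n (toℕ m) * Y (toℕ m) j)
    ≡⟨ ∑-distrib-+ {suc (suc n)} (λ m → α n * (X n (toℕ m) * Y (toℕ m) j))
                                 (λ m → hPrev X n (toℕ m) * Y (toℕ m) j) ⟩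
  ∑[ m < suc (suc n) ] (α n * (X n (toℕ m) * Y (toℕ m) j)) + (0ℚ * Y 0 j + shifted)
    ≡⟨ cong₂ _+_ (sym (*-distribˡ-sum {suc (suc n)} (α n) (λ m → X n (toℕ m) * Y (toℕ m) j)))
                 (trans (cong (_+ shifted) (ℚP.*-zeroˡ (Y 0 j))) (ℚP.+-identityˡ shifted)) ⟩
  α n * ∑[ m < suc (suc n) ] (X n (toℕ m) * Y (toℕ m) j) + shifted
    ≡⟨ cong (λ z → α n * z + shifted) (⊙-as-longer-sum Y ltX n j (ℕP.n≤1+n (suc n))) ⟩
  α n * (X ⊙ Y) n j + shifted ∎
  where
  shifted = ∑[ m < suc n ] (X n (toℕ m) * Y (suc (toℕ m)) j)
  distrib : ∀ a x p y → (a * x + p) * y ≡ a * (x * y) + p * y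
  distrib = solve 4 (λ a x p y → (a :* x :+ p) :* y := a :* (x :* y) :+ p :* y) refl

⊙-shifted-row : ∀ {β : ℕ → ℚ} (X : Mat∞) {Y} → Recurrent (λ _ k → β k) Y → ∀ n j →
  ∑[ m < suc n ] (X n (toℕ m) * Y (suc (toℕ m)) j) ≡ β j * (X ⊙ Y) n j + hPrev (X ⊙ Y) n j
⊙-shifted-row {β} X {Y} recY n j = begin
  ∑[ m < suc n ] (X n (toℕ m) * Y (suc (toℕ m)) j)
    ≡⟨ sum-cong-≗ {suc n} (λ m → trans (cong (X n (toℕ m) *_) (recY (toℕ m) j))
         (distrib (X n (toℕ m)) (β j) (Y (toℕ m) j) (hPrev Y (toℕ m) j))) ⟩
  ∑[ m < suc n ] (β j * (X n (toℕ m) * Y (toℕ m) j) + X n (toℕ m) * hPrev Y (toℕ m) j)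
    ≡⟨ ∑-distrib-+ {suc n} (λ m → β j * (X n (toℕ m) * Y (toℕ m) j))
                           (λ m → X n (toℕ m) * hPrev Y (toℕ m) j) ⟩
  ∑[ m < suc n ] (β j * (X n (toℕ m) * Y (toℕ m) j)) + ∑[ m < suc n ] (X n (toℕ m) * hPrev Y (toℕ m) j)
    ≡⟨ cong₂ _+_ (sym (*-distribˡ-sum {suc n} (β j) (λ m → X n (toℕ m) * Y (toℕ m) j))) (⊙-hPrev X Y n j) ⟩
  β j * (X ⊙ Y) n j + hPrev (X ⊙ Y) n j ∎
  where
  distrib : ∀ x b y p → x * (b * y + p) ≡ b * (x * y) + x * p
  distrib = solve 4 (λ x b y p → x :* (b :* y :+ p) := b :* (x :* y) :+ x :* p) refl

⊙-recurrent : ∀ {α β : ℕ → ℚ} {X Y} → LowerTriangular X →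
  Recurrent (λ n _ → α n) X → Recurrent (λ _ k → β k) Y → Recurrent (λ n k → α n + β k) (X ⊙ Y)
⊙-recurrent {α} {β} {X} {Y} ltX recX recY n j = begin
  (X ⊙ Y) (suc n) j                           ≡⟨ ⊙-suc-row {α} {X} Y ltX recX n j ⟩
  α n * Z + ∑[ m < suc n ] (X n (toℕ m) * Y (suc (toℕ m)) j)
                                              ≡⟨ cong (α n * Z +_) (⊙-shifted-row {β} X {Y} recY n j) ⟩
  α n * Z + (β j * Z + hPrev (X ⊙ Y) n j)     ≡⟨ collect (α n) (β j) Z _ ⟩
  (α n + β j) * Z + hPrev (X ⊙ Y) n j         ∎
  where
  Z = (X ⊙ Y) n j
  collect : ∀ a b z p → a * z + (b * z + p) ≡ (a + b) * z + p
  collect = solve 4 (λ a b z p → a :* z :+ (b :* z :+ p) := (a :+ b) :* z :+ p) refl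

conjugate : ℚ → Mat∞ → Mat∞
conjugate x M n k = x ^ n * M n k * inv x ^ k

LowerTriangular-conjugate : ∀ x {M} → LowerTriangular M → LowerTriangular (conjugate x M)
LowerTriangular-conjugate x {M} ltM n k n<k = begin
  x ^ n * M n k * inv x ^ k  ≡⟨ cong (λ m → x ^ n * m * inv x ^ k) (ltM n k n<k) ⟩
  x ^ n * 0ℚ * inv x ^ k     ≡⟨ cong (_* inv x ^ k) (ℚP.*-zeroʳ (x ^ n)) ⟩
  0ℚ * inv x ^ k             ≡⟨ ℚP.*-zeroˡ (inv x ^ k) ⟩
  0ℚ                         ∎

conjugate-recurrent : ∀ {w} x M → x * inv x ≡ 1ℚ → Recurrent w M →
  Recurrent (λ n k → x * w n k) (conjugate x M)
conjugate-recurrent {w} x M x*x⁻¹≡1 recM n zero = begin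
  x * x ^ n * M (suc n) 0 * 1ℚ                 ≡⟨ cong (λ m → x * x ^ n * m * 1ℚ) (recM n 0) ⟩
  x * x ^ n * (w n 0 * M n 0 + 0ℚ) * 1ℚ        ≡⟨ rearrange x (x ^ n) (w n 0) (M n 0) ⟩
  x * w n 0 * (x ^ n * M n 0 * 1ℚ) + 0ℚ        ∎
  where
  rearrange : ∀ x X w m → x * X * (w * m + 0ℚ) * 1ℚ ≡ x * w * (X * m * 1ℚ) + 0ℚ
  rearrange = solve 4 (λ x X w m →
    x :* X :* (w :* m :+ con 0ℚ) :* con 1ℚ := x :* w :* (X :* m :* con 1ℚ) :+ con 0ℚ) refl
conjugate-recurrent {w} x M x*x⁻¹≡1 recM n (suc k) = begin
  x * X * M (suc n) (suc k) * (inv x * I)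
    ≡⟨ cong (λ m → x * X * m * (inv x * I)) (recM n (suc k)) ⟩
  x * X * (w n (suc k) * M n (suc k) + M n k) * (inv x * I)
    ≡⟨ rearrange x (inv x) X I (w n (suc k)) (M n (suc k)) (M n k) ⟩
  x * w n (suc k) * (X * M n (suc k) * (inv x * I)) + x * inv x * (X * M n k * I)
    ≡⟨ cong (λ c → x * w n (suc k) * (X * M n (suc k) * (inv x * I)) + c * (X * M n k * I)) x*x⁻¹≡1 ⟩
  x * w n (suc k) * (X * M n (suc k) * (inv x * I)) + 1ℚ * (X * M n k * I)
    ≡⟨ cong (x * w n (suc k) * (X * M n (suc k) * (inv x * I)) +_) (ℚP.*-identityˡ (X * M n k * I)) ⟩
  x * w n (suc k) * (X * M n (suc k) * (inv x * I)) + X * M n k * I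
    ∎
  where
  X = x ^ n
  I = inv x ^ k
  rearrange : ∀ x x⁻¹ X I w m m′ →
    x * X * (w * m + m′) * (x⁻¹ * I) ≡ x * w * (X * m * (x⁻¹ * I)) + x * x⁻¹ * (X * m′ * I)
  rearrange = solve 7 (λ x x⁻¹ X I w m m′ →
    x :* X :* (w :* m :+ m′) :* (x⁻¹ :* I) := x :* w :* (X :* m :* (x⁻¹ :* I)) :+ x :* x⁻¹ :* (X :* m′ :* I)) refl

stirling₁ stirling₂ signedBinomial : Mat∞
stirling₁ n k = fromℕ (stir1 (suc n) (suc k))
stirling₂ n k = fromℕ (stir2 (suc n) (suc k))
signedBinomial n k = (- 1ℚ) ^ (n ℕ.∸ k) * fromℕ (n C k)

stirling₁-recurrent : Recurrent (λ n _ → fromℕ (suc n)) stirling₁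
stirling₁-recurrent n zero = trans (fromℕ-homo-+ (suc n ℕ.* s) 0) (cong (_+ 0ℚ) (fromℕ-homo-* (suc n) s))
  where s = stir1 (suc n) 1
stirling₁-recurrent n (suc k) = trans (fromℕ-homo-+ (suc n ℕ.* s) t) (cong (_+ fromℕ t) (fromℕ-homo-* (suc n) s))
  where s = stir1 (suc n) (suc (suc k)); t = stir1 (suc n) (suc k)

stirling₂-recurrent : Recurrent (λ _ k → fromℕ (suc k)) stirling₂
stirling₂-recurrent n zero = trans (fromℕ-homo-+ (1 ℕ.* s) 0) (cong (_+ 0ℚ) (fromℕ-homo-* 1 s))
  where s = stir2 (suc n) 1
stirling₂-recurrent n (suc k) =
  trans (fromℕ-homo-+ (suc (suc k) ℕ.* s) t) (cong (_+ fromℕ t) (fromℕ-homo-* (suc (suc k)) s))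
  where s = stir2 (suc n) (suc (suc k)); t = stir2 (suc n) (suc k)

-- n ∸ k = 1 + (n ∸ (k + 1)) only holds for k < n; for k ≥ n the binomial factor vanishes instead.
signedBinomial-sign : ∀ n k → (- 1ℚ) ^ (n ℕ.∸ k) * fromℕ (n C suc k) ≡ - 1ℚ * signedBinomial n (suc k)
signedBinomial-sign n k with k ℕ.<? n
... | yes k<n = trans (cong (λ e → (- 1ℚ) ^ e * fromℕ (n C suc k)) (ℕP.+-∸-assoc 1 k<n))
                      (ℚP.*-assoc (- 1ℚ) ((- 1ℚ) ^ (n ℕ.∸ suc k)) (fromℕ (n C suc k)))
... | no k≮n rewrite k>n⇒nCk≡0 (s≤s (ℕP.≮⇒≥ k≮n)) =
  trans (ℚP.*-zeroʳ ((- 1ℚ) ^ (n ℕ.∸ k)))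
        (sym (trans (cong (- 1ℚ *_) (ℚP.*-zeroʳ ((- 1ℚ) ^ (n ℕ.∸ suc k)))) (ℚP.*-zeroʳ (- 1ℚ))))

signedBinomial-recurrent : Recurrent (λ _ _ → - 1ℚ) signedBinomial
signedBinomial-recurrent n zero =
  solve 1 (λ s → (:- con 1ℚ) :* s :* con 1ℚ := (:- con 1ℚ) :* (s :* con 1ℚ) :+ con 0ℚ) refl ((- 1ℚ) ^ n)
signedBinomial-recurrent n (suc k) = begin
  s * fromℕ (suc n C suc k)
    ≡⟨ cong (s *_) (trans (cong fromℕ (sym (nCk+nC[k+1]≡[n+1]C[k+1] n k))) (fromℕ-homo-+ (n C k) (n C suc k))) ⟩
  s * (fromℕ (n C k) + fromℕ (n C suc k))
    ≡⟨ ℚP.*-distribˡ-+ s (fromℕ (n C k)) (fromℕ (n C suc k)) ⟩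
  s * fromℕ (n C k) + s * fromℕ (n C suc k)
    ≡⟨ ℚP.+-comm (s * fromℕ (n C k)) (s * fromℕ (n C suc k)) ⟩
  s * fromℕ (n C suc k) + signedBinomial n k
    ≡⟨ cong (_+ signedBinomial n k) (signedBinomial-sign n k) ⟩
  - 1ℚ * signedBinomial n (suc k) + signedBinomial n k ∎
  where s = (- 1ℚ) ^ (n ℕ.∸ k)

stirling₁-lowerTriangular : LowerTriangular stirling₁
stirling₁-lowerTriangular = recurrent⇒lowerTriangular {λ n _ → fromℕ (suc n)} (λ k → refl) stirling₁-recurrent

stirling₂-lowerTriangular : LowerTriangular stirling₂
stirling₂-lowerTriangular = recurrent⇒lowerTriangular {λ _ k → fromℕ (suc k)}
  (λ k → cong fromℕ (trans (ℕP.+-identityʳ _) (ℕP.*-zeroʳ (suc (suc k))))) stirling₂-recurrent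

signedBinomial-lowerTriangular : LowerTriangular signedBinomial
signedBinomial-lowerTriangular = recurrent⇒lowerTriangular {λ _ _ → - 1ℚ} (λ k → refl) signedBinomial-recurrent

diagPow-diagonal : ∀ {N} x (p : Fin N) → diagPow N x p p ≡ x ^ toℕ p
diagPow-diagonal x p with toℕ p ℕ.≟ toℕ p
... | yes _ = refl
... | no p≢p = ⊥-elim (p≢p refl)

diagPow-offDiagonal : ∀ {N} x {p q : Fin N} → p ≢ q → diagPow N x p q ≡ 0ℚ
diagPow-offDiagonal x {p} {q} p≢q with toℕ p ℕ.≟ toℕ q
... | yes p≡q = ⊥-elim (p≢q (FinP.toℕ-injective p≡q))
... | no _ = refl

diagPow-⊗ : ∀ {N} x (M : Mat N) p q → (diagPow N x ⊗ M) p q ≡ x ^ toℕ p * M p q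
diagPow-⊗ {suc N} x M p q = begin
  Σ (λ j → diagPow _ x p j * M j q)     ≡⟨ Σ≡sum (λ j → diagPow _ x p j * M j q) ⟩
  sum (λ j → diagPow _ x p j * M j q)   ≡⟨ sum-single (λ j → diagPow _ x p j * M j q) p
                                              (λ j j≢p → trans (cong (_* M j q) (diagPow-offDiagonal x (j≢p ∘ sym)))
                                                                (ℚP.*-zeroˡ (M j q))) ⟩
  diagPow _ x p p * M p q               ≡⟨ cong (_* M p q) (diagPow-diagonal x p) ⟩
  x ^ toℕ p * M p q                     ∎

⊗-diagPow : ∀ {N} x (M : Mat N) p q → (M ⊗ diagPow N x) p q ≡ M p q * x ^ toℕ q
⊗-diagPow {suc N} x M p q = begin
  Σ (λ j → M p j * diagPow _ x j q)     ≡⟨ Σ≡sum (λ j → M p j * diagPow _ x j q) ⟩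
  sum (λ j → M p j * diagPow _ x j q)   ≡⟨ sum-single (λ j → M p j * diagPow _ x j q) q
                                              (λ j j≢q → trans (cong (M p j *_) (diagPow-offDiagonal x j≢q))
                                                                (ℚP.*-zeroʳ (M p j))) ⟩
  M p q * diagPow _ x q q               ≡⟨ cong (M p q *_) (diagPow-diagonal x q) ⟩
  M p q * x ^ toℕ q                     ∎

conjugate-truncation : ∀ N x M (p q : Fin N) →
  (diagPow N x ⊗ hMat M N ⊗ diagPowInv N x) p q ≡ hMat (conjugate x M) N p q
conjugate-truncation N x M p q =
  trans (⊗-diagPow (inv x) (diagPow N x ⊗ hMat M N) p q) (cong (_* inv x ^ toℕ q) (diagPow-⊗ x (hMat M N) p q))

⊗-cong : ∀ {N} {A A′ B B′ : Mat N} → (∀ p q → A p q ≡ A′ p q) → (∀ p q → B p q ≡ B′ p q) →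
  ∀ p q → (A ⊗ B) p q ≡ (A′ ⊗ B′) p q
⊗-cong {N} {A} {A′} {B} {B′} A≡A′ B≡B′ p q = begin
  Σ (λ j → A p j * B j q)      ≡⟨ Σ≡sum (λ j → A p j * B j q) ⟩
  sum (λ j → A p j * B j q)    ≡⟨ sum-cong-≗ {N} (λ j → cong₂ _*_ (A≡A′ p j) (B≡B′ j q)) ⟩
  sum (λ j → A′ p j * B′ j q)  ≡⟨ sym (Σ≡sum (λ j → A′ p j * B′ j q)) ⟩
  Σ (λ j → A′ p j * B′ j q)    ∎

truncation-⊙ : ∀ {X} Y → LowerTriangular X → ∀ N (p q : Fin N) →
  (hMat X N ⊗ hMat Y N) p q ≡ hMat (X ⊙ Y) N p q
truncation-⊙ {X} Y ltX N p q = trans (Σ≡sum {N} (λ m → X (toℕ p) (toℕ m) * Y (toℕ m) (toℕ q)))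
  (⊙-as-longer-sum Y ltX {N} (toℕ p) (toℕ q) (FinP.toℕ<n p))

truncations-determine : ∀ {X Y : Mat∞} →
  (∀ n (p q : Fin (suc n)) → hMat X (suc n) p q ≡ hMat Y (suc n) p q) → ∀ n k → X n k ≡ Y n k
truncations-determine {X} {Y} X≡Y n k =
  subst₂ (λ i j → X i j ≡ Y i j) (FinP.toℕ-fromℕ< n<N) (FinP.toℕ-fromℕ< k<N)
    (X≡Y (n ℕ.+ k) (Fin.fromℕ< n<N) (Fin.fromℕ< k<N))
  where
  n<N : n < suc (n ℕ.+ k)
  n<N = s≤s (ℕP.m≤m+n n k)
  k<N : k < suc (n ℕ.+ k)
  k<N = s≤s (ℕP.m≤n+m k n)

module _ (a d r : ℤ) where
  private
    a′ d′ r′ r₁ : ℚ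
    a′ = a ℚ./ 1
    d′ = d ℚ./ 1
    r′ = r ℚ./ 1
    r₁ = (r ℤ.+ d) ℚ./ 1

    aca⁻¹ rPr⁻¹ dSd⁻¹ : Mat∞
    aca⁻¹ = conjugate a′ stirling₁
    rPr⁻¹ = conjugate r₁ signedBinomial
    dSd⁻¹ = conjugate d′ stirling₂

    aca⁻¹-lowerTriangular : LowerTriangular aca⁻¹
    aca⁻¹-lowerTriangular = LowerTriangular-conjugate a′ stirling₁-lowerTriangular

    aca⁻¹rPr⁻¹-lowerTriangular : LowerTriangular (aca⁻¹ ⊙ rPr⁻¹)
    aca⁻¹rPr⁻¹-lowerTriangular =
      LowerTriangular-⊙ aca⁻¹ (LowerTriangular-conjugate r₁ signedBinomial-lowerTriangular)

  coefficient : ℕ → ℕ → ℚ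
  coefficient m k = a′ * fromℕ (suc m) + d′ * fromℕ k ℚ.- r′

  factorProduct : Mat∞
  factorProduct = aca⁻¹ ⊙ rPr⁻¹ ⊙ dSd⁻¹

  factorProduct-00 : factorProduct 0 0 ≡ 1ℚ
  factorProduct-00 = refl

  factorProduct-lowerTriangular : LowerTriangular factorProduct
  factorProduct-lowerTriangular =
    LowerTriangular-⊙ (aca⁻¹ ⊙ rPr⁻¹) (LowerTriangular-conjugate d′ stirling₂-lowerTriangular)

  factorProduct-recurrent : a ≢ 0ℤ → d ≢ 0ℤ → r ℤ.+ d ≢ 0ℤ → Recurrent coefficient factorProduct
  factorProduct-recurrent a≢0 d≢0 r₁≢0 n k =
    trans (⊙-recurrent {λ n → a′ * fromℕ (suc n) + r₁ * - 1ℚ} {λ k → d′ * fromℕ (suc k)}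
             aca⁻¹rPr⁻¹-lowerTriangular aca⁻¹rPr⁻¹-recurrent dSd⁻¹-recurrent n k)
          (cong (λ c → c * factorProduct n k + hPrev factorProduct n k) (coefficients-add-up n k))
    where
    aca⁻¹rPr⁻¹-recurrent : Recurrent (λ n _ → a′ * fromℕ (suc n) + r₁ * - 1ℚ) (aca⁻¹ ⊙ rPr⁻¹)
    aca⁻¹rPr⁻¹-recurrent = ⊙-recurrent {λ n → a′ * fromℕ (suc n)} {λ _ → r₁ * - 1ℚ} aca⁻¹-lowerTriangular
      (conjugate-recurrent a′ stirling₁ (inv-inverseʳ a′ (/1-≢0 a a≢0)) stirling₁-recurrent)
      (conjugate-recurrent r₁ signedBinomial (inv-inverseʳ r₁ (/1-≢0 (r ℤ.+ d) r₁≢0)) signedBinomial-recurrent)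
    dSd⁻¹-recurrent : Recurrent (λ _ k → d′ * fromℕ (suc k)) dSd⁻¹
    dSd⁻¹-recurrent = conjugate-recurrent d′ stirling₂ (inv-inverseʳ d′ (/1-≢0 d d≢0)) stirling₂-recurrent
    coefficients-add-up : ∀ n k → a′ * fromℕ (suc n) + r₁ * - 1ℚ + d′ * fromℕ (suc k) ≡ coefficient n k
    coefficients-add-up n k rewrite /1-homo-+ r d | fromℕ-homo-+ 1 k =
      solve 5 (λ a N d r K → a :* N :+ (r :+ d) :* (:- con 1ℚ) :+ d :* (con 1ℚ :+ K) := a :* N :+ d :* K :- r)
        refl a′ (fromℕ (suc n)) d′ r′ (fromℕ k)

  factorization-truncates : ∀ N (p q : Fin N) →
    ((diagPow N a′ ⊗ cMat N ⊗ diagPowInv N a′) ⊗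
    (diagPow N r₁ ⊗ PInvMat N ⊗ diagPowInv N r₁) ⊗
    (diagPow N d′ ⊗ SMat N ⊗ diagPowInv N d′)) p q ≡ hMat factorProduct N p q
  factorization-truncates N p q = trans
    (⊗-cong (λ p q → trans (⊗-cong (conjugate-truncation N a′ stirling₁)
                                   (conjugate-truncation N r₁ signedBinomial) p q)
                           (truncation-⊙ rPr⁻¹ aca⁻¹-lowerTriangular N p q))
            (conjugate-truncation N d′ stirling₂) p q)
    (truncation-⊙ dSd⁻¹ aca⁻¹rPr⁻¹-lowerTriangular N p q)

proposition8p4 : (a d r : ℤ) → a ≢ 0ℤ → d ≢ 0ℤ → r ℤ.+ d ≢ 0ℤ →
    (h : ℕ → ℕ → ℚ) → (∀ n k → n < k → h n k ≡ 0ℚ) →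
    Recurrence a d r h ⇔ (∀ n → Factorization a d r h (suc n))
proposition8p4 a d r a≢0 d≢0 r₁≢0 h h-lowerTriangular = mk⇔ factorize recur
  where
  H : Mat∞
  H = factorProduct a d r

  H-recurrent : Recurrent (coefficient a d r) H
  H-recurrent = factorProduct-recurrent a d r a≢0 d≢0 r₁≢0

  factorize : Recurrence a d r h → ∀ n → Factorization a d r h (suc n)
  factorize (h₀₀≡1 , h-recurrent) n p q =
    trans (h≡H (toℕ p) (toℕ q)) (sym (factorization-truncates a d r (suc n) p q))
    where
    h≡H : ∀ n k → h n k ≡ H n k
    h≡H = recurrence-unique {coefficient a d r} h-lowerTriangular (factorProduct-lowerTriangular a d r)
            (trans h₀₀≡1 (sym (factorProduct-00 a d r))) h-recurrent H-recurrent

  recur : (∀ n → Factorization a d r h (suc n)) → Recurrence a d r h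
  recur factorization =
    trans (h≡H 0 0) (factorProduct-00 a d r) ,
    λ m k _ → Recurrent-resp {coefficient a d r} (λ n k → sym (h≡H n k)) H-recurrent m k
    where
    h≡H : ∀ n k → h n k ≡ H n k
    h≡H = truncations-determine (λ n p q → trans (factorization n p q) (factorization-truncates a d r (suc n) p q))
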